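{- Let $\tau$ be a correct translation. Then for any initial storage the prefix of $\tau(!)$ cannot be $T_1^+T_2$ nor $T_2^+T_1$.
   Context: SYNCSIMPLE: subprocesses $U ::= \checkmark \mid 0 \mid\ !U \mid\ ?U$; processes are parallel compositions (multisets) of subprocesses; reduction $!U_1 \mid ?U_2 \mid P \to U_1 \mid U_2 \mid P$; successful = has a parallel component $\checkmark$; may-convergent = reduces to a successful process; must-convergent = every reduct is may-convergent; must-divergent = no reduction to a successful process. LOCKSIMPLE$_{2,IS}$: two locks, each full ($\blacksquare$) or empty ($\Box$), initial store $IS$; subprocesses $U ::= 0 \mid \checkmark \mid P_iU \mid T_iU$ ($i\in\{1,2\}$); $P_i$ on empty lock $i$ fills it, on a full lock blocks; $T_i$ never blocks and empties lock $i$. Convergence evaluated from $(P,IS)$. $\tau$ is a compositional translation SYNCSIMPLE $\to$ LOCKSIMPLE$_{2,IS}$ ($\tau(0)=0$, $\tau(\checkmark)=\checkmark$, $\tau$ commutes with parallel composition, $\tau(!U)=\tau(!)\tau(U)$, $\tau(?U)=\tau(?)\tau(U)$); correct = preserve and reflect may- and must-convergence. This lemma is stated in the setting where $\tau$ has blocking type $(P_1P_1,P_2P_2)$ (i.e. $\tau(!)$ executed alone from $IS$ deadlocks at the second $P_1$ of a prefix $R_1P_1R_2P_1$ with $R_2$ free of $P_1,T_1$, and $\tau(?)$ likewise with $P_2$), though the argument holds for any initial store. $T_j^+$ denotes one or more $T_j$. -}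

module Defs where

open import Data.Bool using (Bool; true; false)
open import Data.Nat using (ℕ; zero; suc; _+_)
open import Data.List using (List; []; _∷_; _++_; length; replicate)
open import Data.List.Relation.Unary.Any using (Any)
open import Data.List.Relation.Unary.All using (All)
open import Data.List.Relation.Binary.Permutation.Propositional using (_↭_)
open import Data.Product using (_×_; _,_; ∃; ∃-syntax; Σ-syntax)
open import Data.Maybe using (Maybe; just; nothing)
open import Relation.Binary.PropositionalEquality using (_≡_)
open import Relation.Binary.Construct.Closure.ReflexiveTransitive using (Star)
open import Relation.Nullary using (¬_)
open import Function.Bundles using (_⇔_)

data End : Set where
  tick : End
  nil  : End

data SAct : Set where
  send : SAct
  recv : SAct

SSub : Set
SSub = List SAct × End

-- processes: parallel compositions = multisets, represented as lists
-- (taken up to permutation in the reduction relation)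
SProc : Set
SProc = List SSub

data _⟶S_ : SProc → SProc → Set where
  sync : ∀ {P} u₁ e₁ u₂ e₂ R →
         P ↭ ((send ∷ u₁ , e₁) ∷ (recv ∷ u₂ , e₂) ∷ R) →
         P ⟶S ((u₁ , e₁) ∷ (u₂ , e₂) ∷ R)

_⟶S*_ : SProc → SProc → Set
_⟶S*_ = Star _⟶S_

SSuccessful : SProc → Set
SSuccessful P = Any (λ u → u ≡ ([] , tick)) P

SMayConv : SProc → Set
SMayConv P = ∃[ Q ] (P ⟶S* Q × SSuccessful Q)

SMustConv : SProc → Set
SMustConv P = ∀ Q → P ⟶S* Q → SMayConv Q

data Lock : Set where
  l₁ l₂ : Lock

data LAct : Set where
  P : Lock → LAct
  T : Lock → LAct

-- store: (lock 1 full?, lock 2 full?)   true = full ■, false = empty □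
Store : Set
Store = Bool × Bool

-- executing a single action on a store; nothing = blocked
step : Store → LAct → Maybe Store
step (false , b) (P l₁) = just (true , b)
step (true  , b) (P l₁) = nothing
step (a , false) (P l₂) = just (a , true)
step (a , true)  (P l₂) = nothing
step (a , b) (T l₁) = just (false , b)
step (a , b) (T l₂) = just (a , false)

LSub : Set
LSub = List LAct × End

LProc : Set
LProc = List LSub

LConf : Set
LConf = LProc × Store

data _⟶L_ : LConf → LConf → Set where
  act : ∀ {Pr s s'} a w e R →
        Pr ↭ ((a ∷ w , e) ∷ R) →
        step s a ≡ just s' →
        (Pr , s) ⟶L (((w , e) ∷ R) , s')

_⟶L*_ : LConf → LConf → Set
_⟶L*_ = Star _⟶L_

LSuccessful : LConf → Set
LSuccessful (Pr , s) = Any (λ u → u ≡ ([] , tick)) Pr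

LMayConv : LConf → Set
LMayConv C = ∃[ D ] (C ⟶L* D × LSuccessful D)

LMustConv : LConf → Set
LMustConv C = ∀ D → C ⟶L* D → LMayConv D

-- Compositional translations: determined by the words τ(!) and τ(?).

record Translation : Set where
  field
    τ! : List LAct
    τ? : List LAct
open Translation public

trAct : Translation → SAct → List LAct
trAct τ send = τ! τ
trAct τ recv = τ? τ

trWord : Translation → List SAct → List LAct
trWord τ []       = []
trWord τ (a ∷ as) = trAct τ a ++ trWord τ as

trSub : Translation → SSub → LSub
trSub τ (w , e) = trWord τ w , e

trProc : Translation → SProc → LProc
trProc τ []       = []
trProc τ (u ∷ us) = trSub τ u ∷ trProc τ us

Correct : Store → Translation → Set
Correct IS τ = ∀ (Pr : SProc) →
  (SMayConv Pr ⇔ LMayConv (trProc τ Pr , IS)) ×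
  (SMustConv Pr ⇔ LMustConv (trProc τ Pr , IS))

data Outcome : Set where
  done  : Store → Outcome
  stuck : ℕ → Outcome       -- blocked at the action with this (0-based) index

shift : Outcome → Outcome
shift (done s)  = done s
shift (stuck n) = stuck (suc n)

run : Store → List LAct → Outcome
run s []      = done s
run s (a ∷ w) with step s a
... | just s' = shift (run s' w)
... | nothing = stuck 0

BlocksPP : Lock → Store → List LAct → Set
BlocksPP i IS w =
  ∃[ R₁ ] ∃[ R₂ ] ∃[ R₃ ]
    (w ≡ R₁ ++ P i ∷ R₂ ++ P i ∷ R₃) ×
    All (λ a → ¬ (a ≡ P i) × ¬ (a ≡ T i)) R₂ ×
    (run IS w ≡ stuck (length R₁ + suc (length R₂)))

BlockingTypeP1P1P2P2 : Store → Translation → Set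
BlockingTypeP1P1P2P2 IS τ = BlocksPP l₁ IS (τ! τ) × BlocksPP l₂ IS (τ? τ)

HasPrefixTplusT : Lock → Lock → List LAct → Set
HasPrefixTplusT i j w = ∃[ n ] ∃[ rest ] (w ≡ replicate (suc n) (T i) ++ T j ∷ rest)

-- If τ(!) starts with T₁⁺T₂ (or T₂⁺T₁), running that prefix of a copy of
-- τ(!) empties both locks whatever the store, and from the empty store any
-- single action can fire.  So in  τ(!)✓ | τ(!)0 | … | τ(!)0  with one idle
-- copy per action of τ(!), each action of the ✓-component can be enabled by
-- first resetting the store with a fresh idle copy: the translation
-- may-converges.  The source process  !✓ | !0 | … | !0  has no reduction
-- and no ✓, so it does not — contradicting correctness.
module Submission where

open import Defs
open import Data.Bool using (true; false)
open import Data.Empty using (⊥-elim)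
open import Data.Nat using (ℕ; zero; suc)
open import Data.List using (List; []; _∷_; _++_; length; replicate)
open import Data.List.Properties using (++-identityʳ)
open import Data.List.Relation.Unary.Any using (here; there)
open import Data.List.Relation.Unary.All using (All; []; _∷_)
open import Data.List.Relation.Binary.Permutation.Propositional
  using (_↭_; ↭-refl; ↭-sym; ↭-trans; prep; swap)
open import Data.List.Relation.Binary.Permutation.Propositional.Properties
  using (All-resp-↭; Any-resp-↭) renaming (shift to ↭-shift)
open import Data.Maybe using (just)
open import Data.Product using (_×_; _,_; ∃-syntax; proj₁)
open import Function.Bundles using (Equivalence)
open import Relation.Binary.PropositionalEquality
  using (_≡_; _≢_; refl; sym; trans; cong; cong₂; subst)
open import Relation.Binary.Construct.Closure.ReflexiveTransitive
  using (ε; _◅_; _◅◅_)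
open import Relation.Nullary using (¬_)

empty : Store
empty = false , false

clear : Lock → Store → Store
clear l₁ (a , b) = false , b
clear l₂ (a , b) = a , false

step-T : ∀ i s → step s (T i) ≡ just (clear i s)
step-T l₁ (false , false) = refl
step-T l₁ (false , true)  = refl
step-T l₁ (true  , false) = refl
step-T l₁ (true  , true)  = refl
step-T l₂ (false , false) = refl
step-T l₂ (false , true)  = refl
step-T l₂ (true  , false) = refl
step-T l₂ (true  , true)  = refl

clear-idem : ∀ i s → clear i (clear i s) ≡ clear i s
clear-idem l₁ (a , b) = refl
clear-idem l₂ (a , b) = refl

clear-clear≡empty : ∀ {i j} → i ≢ j → ∀ s → clear j (clear i s) ≡ empty
clear-clear≡empty {l₁} {l₁} i≢j _       = ⊥-elim (i≢j refl)
clear-clear≡empty {l₁} {l₂} _   (a , b) = refl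
clear-clear≡empty {l₂} {l₁} _   (a , b) = refl
clear-clear≡empty {l₂} {l₂} i≢j _       = ⊥-elim (i≢j refl)

step-empty-unblocked : ∀ a → ∃[ s ] step empty a ≡ just s
step-empty-unblocked (P l₁) = _ , refl
step-empty-unblocked (P l₂) = _ , refl
step-empty-unblocked (T l₁) = _ , refl
step-empty-unblocked (T l₂) = _ , refl

T-steps-from-cleared : ∀ i n w e R s →
  (((replicate n (T i) ++ w , e) ∷ R) , clear i s) ⟶L* (((w , e) ∷ R) , clear i s)
T-steps-from-cleared i zero    w e R s = ε
T-steps-from-cleared i (suc n) w e R s =
  act (T i) _ e R ↭-refl (trans (step-T i (clear i s)) (cong just (clear-idem i s)))
  ◅ T-steps-from-cleared i n w e R s

Resets : List LAct → Set
Resets w = ∃[ r ] ∀ s R → (((w , nil) ∷ R) , s) ⟶L* (((r , nil) ∷ R) , empty)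

T⁺T-prefix-resets : ∀ {i j} → i ≢ j → ∀ {w} → HasPrefixTplusT i j w → Resets w
T⁺T-prefix-resets {i} {j} i≢j (n , rest , refl) = rest , λ s R →
  act (T i) _ nil R ↭-refl (step-T i s)
  ◅ T-steps-from-cleared i n (T j ∷ rest) nil R s
  ◅◅ act (T j) rest nil R ↭-refl
       (trans (step-T j (clear i s)) (cong just (clear-clear≡empty i≢j s)))
  ◅ ε

LMayConv-resp-↭ : ∀ {Pr Pr′ s} → Pr ↭ Pr′ → LMayConv (Pr , s) → LMayConv (Pr′ , s)
LMayConv-resp-↭ p (_ , ε , success) = _ , ε , Any-resp-↭ p success
LMayConv-resp-↭ p (D , act a w e R q step≡ ◅ steps , success) =
  D , act a w e R (↭-trans (↭-sym p) q) step≡ ◅ steps , success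

LMayConv-⟵* : ∀ {C D} → C ⟶L* D → LMayConv D → LMayConv C
LMayConv-⟵* steps (E , steps′ , success) = E , steps ◅◅ steps′ , success

helpers-enable-success : ∀ {hw} → Resets hw → ∀ u J s →
  LMayConv (((u , tick) ∷ replicate (length u) (hw , nil) ++ J) , s)
helpers-enable-success _ [] J s = _ , ε , here refl
helpers-enable-success {hw} reset@(r , resets) (a ∷ u) J s
  with step-empty-unblocked a
... | s′ , step≡ =
  LMayConv-resp-↭ (swap _ _ ↭-refl)
    (LMayConv-⟵* (resets s ((a ∷ u , tick) ∷ H ++ J))
      (LMayConv-⟵* (act a u tick ((r , nil) ∷ H ++ J) (swap _ _ ↭-refl) step≡ ◅ ε)
        (LMayConv-resp-↭ (prep _ (↭-shift (r , nil) H J))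
          (helpers-enable-success reset u ((r , nil) ∷ J) s′))))
  where
  H = replicate (length u) (hw , nil)

data StartsWithSend : SSub → Set where
  send∷ : ∀ w e → StartsWithSend (send ∷ w , e)

only-sends-¬SMayConv : ∀ {Pr} → All StartsWithSend Pr → ¬ SMayConv Pr
only-sends-¬SMayConv heads (_ , ε , success) = no-tick heads success
  where
  no-tick : ∀ {Q} → All StartsWithSend Q → ¬ SSuccessful Q
  no-tick (send∷ _ _ ∷ _) (here ())
  no-tick (_ ∷ heads)     (there success) = no-tick heads success
only-sends-¬SMayConv heads (_ , sync _ _ _ _ _ p ◅ _ , _)
  with All-resp-↭ p heads
... | _ ∷ () ∷ _

sends : ℕ → SProc
sends k = (send ∷ [] , tick) ∷ replicate k (send ∷ [] , nil)

sends-start-with-send : ∀ k → All StartsWithSend (sends k)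
sends-start-with-send k = send∷ [] tick ∷ idle k
  where
  idle : ∀ k → All StartsWithSend (replicate k (send ∷ [] , nil))
  idle zero    = []
  idle (suc k) = send∷ [] nil ∷ idle k

trProc-sends : ∀ τ k →
  trProc τ (sends k) ≡ (τ! τ , tick) ∷ replicate k (τ! τ , nil) ++ []
trProc-sends τ k =
  cong₂ _∷_ (cong (_, tick) (++-identityʳ (τ! τ)))
            (trans (idle k) (sym (++-identityʳ _)))
  where
  idle : ∀ k → trProc τ (replicate k (send ∷ [] , nil)) ≡ replicate k (τ! τ , nil)
  idle zero    = refl
  idle (suc k) = cong₂ _∷_ (cong (_, nil) (++-identityʳ (τ! τ))) (idle k)

correct⇒¬Resets-τ! : ∀ {IS τ} → Correct IS τ → ¬ Resets (τ! τ)
correct⇒¬Resets-τ! {IS} {τ} correct reset =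
  only-sends-¬SMayConv (sends-start-with-send k)
    (Equivalence.from (proj₁ (correct (sends k)))
      (subst (λ Pr → LMayConv (Pr , IS)) (sym (trProc-sends τ k))
        (helpers-enable-success reset (τ! τ) [] IS)))
  where
  k = length (τ! τ)

lemma5p3 : ∀ (IS : Store) (τ : Translation) →
    BlockingTypeP1P1P2P2 IS τ → Correct IS τ →
    ¬ HasPrefixTplusT l₁ l₂ (τ! τ) × ¬ HasPrefixTplusT l₂ l₁ (τ! τ)
lemma5p3 IS τ _ correct =
  (λ prefix → correct⇒¬Resets-τ! correct (T⁺T-prefix-resets (λ ()) prefix)) ,
  (λ prefix → correct⇒¬Resets-τ! correct (T⁺T-prefix-resets (λ ()) prefix))
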